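{- For a positive integer $N$, let $\Phi(N)$ denote the number of cyclic subgroups of order $N$ of $(\mathbb{Z}/N\mathbb{Z})^2$ (equivalently, the number of cyclic isogenies of degree $N$ from a given elliptic curve, for $N$ coprime to the characteristic); in particular $\Phi(\ell^e)=\ell^{e-1}(\ell+1)$ for a prime $\ell$ and $e\ge 1$, and $\Phi$ is multiplicative. There exist a bound $B$ and constants $B_0, C_0, C_1, C_2$ with $1<C_1<C_2$ such that for every integer $N>B$ there exist an integer $n<B_0\log(N)$ and integers $(e_i)_{1\le i\le n}$ with the following property: if $\ell_i$ denotes the $(n-i+1)$-th smallest prime and $L_i=\ell_i^{e_i}$ for $1\le i\le n$, then \begin{itemize} \item $\sqrt{C_0\log(N)}\le \Phi(L_i)< C_0\log(N)$ for all $1\le i\le n-1$, \item $(C_0/2)\log(N)\le \Phi(L_n)<C_0\log(N)$, and \item $C_1N\le \prod_{i=1}^n\Phi(L_i)<C_2N$. \end{itemize}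
   Context: $\log$ denotes the natural logarithm. The smallest prime is $2$, so $\ell_n=2$ and $\ell_1$ is the $n$-th prime. -}

module Defs where

open import Data.Nat using (ℕ; zero; suc; _+_; _*_; _∸_; _^_; _≤_; _<_)
open import Data.Nat.Primality using (Prime; prime?)
open import Data.List using (length; filter; upTo)
open import Data.Product using (_×_)
open import Relation.Binary.PropositionalEquality using (_≡_)

-- Φ on prime powers:  Φ(ℓ^0) = Φ(1) = 1,  Φ(ℓ^e) = ℓ^(e-1) (ℓ+1) for e ≥ 1.
-- (Only values of Φ at prime powers occur in the statement.)
Φpp : ℕ → ℕ → ℕ
Φpp ℓ zero    = 1
Φpp ℓ (suc e) = ℓ ^ e * (ℓ + 1)

primeCount : ℕ → ℕ
primeCount x = length (filter prime? (upTo (suc x)))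

-- p is the k-th smallest prime (k = 1 gives p = 2)
IsNthPrime : ℕ → ℕ → Set
IsNthPrime k p = Prime p × primeCount p ≡ k

prod : ℕ → (ℕ → ℕ) → ℕ
prod zero    f = 1
prod (suc n) f = prod n f * f (suc n)

-- Comparisons with C·log₂ N for a positive rational constant C = a / b,
-- written without reals (log₂ is monotone, all quantities are ≥ 0):
--   x < (a/b) log₂ N   ⇔  2^(b x) < N^a
LtClog : ℕ → ℕ → ℕ → ℕ → Set
LtClog x a b N = 2 ^ (b * x) < N ^ a

--   √((a/b) log₂ N) ≤ x  ⇔  (a/b) log₂ N ≤ x²  ⇔  N^a ≤ 2^(b x²)
SqrtClogLe : ℕ → ℕ → ℕ → ℕ → Set
SqrtClogLe x a b N = N ^ a ≤ 2 ^ (b * (x * x))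

--   ((a/b)/2) log₂ N ≤ x  ⇔  N^a ≤ 2^(2 b x)
HalfClogLe : ℕ → ℕ → ℕ → ℕ → Set
HalfClogLe x a b N = N ^ a ≤ 2 ^ (2 * b * x)

{-# OPTIONS --safe #-}
module Submission where

open import Defs
open import Data.Nat
open import Data.Nat.Properties
open import Data.Nat.DivMod
open import Data.Nat.Divisibility
open import Data.Nat.Primality
open import Data.Nat.Primality.Factorisation using (factorise)
open import Data.Nat.Combinatorics using (_C_; nCk≡n!/k![n-k]!; k![n∸k]!∣n!)
open import Data.Nat.ListAction using (product)
open import Data.Nat.Induction using (<-rec)
open import Data.Nat.Tactic.RingSolver using (solve-∀)
open import Data.List using ([]; _∷_; length; filter; upTo; _++_; [_])
open import Data.List.Properties using (upTo-∷ʳ; filter-++; length-++; filter-accept; filter-reject; length-filter; length-upTo)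
open import Data.List.Relation.Unary.All using (_∷_)
open import Data.Product
open import Data.Sum using (_⊎_; inj₁; inj₂)
open import Data.Empty using (⊥-elim)
open import Data.Unit using (tt)
open import Function using (_∘_; _∘′_)
open import Relation.Nullary
open import Relation.Nullary.Decidable using (from-yes)
open import Relation.Unary using (Decidable)
open import Relation.Binary.Definitions using (tri<; tri≈; tri>)
open import Relation.Binary.PropositionalEquality hiding ([_])

-- Put t = ⌊log₂ N⌋ and K = 5t, and let s be least with s² ≥ K + 5, so that every x with
-- s ≤ x < K satisfies √(5 log₂ N) ≤ x < 5 log₂ N.  For the prime 2 take the exponent e for which
-- Φ(2^e) is the first value with 2 Φ(2^e) ≥ 5 log₂ N.  For every other prime p ≤ 4t the values
-- Φ(p^e) lying in [s, K) form a ladder m, mp, …, mp^r.  Chebyshev's bound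
-- 2^(2m) ≤ (2m+1)^(π(2m)+1), obtained from the central binomial coefficient and Legendre's
-- formula, makes the product of the tops of all these ladders exceed 2N.  Take the shortest initial
-- segment of primes for which it does, and choose rungs greedily from the largest prime down,
-- each time the highest rung keeping the product at most 6N.  The ladders below a prime q together
-- span a factor of at least q/3 (their top-to-bottom ratios multiply to at least q/3), so the greedy
-- choice never falls short by more than a factor 3 and the final product lies in (2N, 6N].

n<2^n : ∀ n → n < 2 ^ n
n<2^n zero    = z<s
n<2^n (suc n) = begin-strict
  suc n            ≤⟨ n<2^n n ⟩
  2 ^ n            <⟨ m<m+n (2 ^ n) (m^n>0 2 n) ⟩
  2 ^ n + 2 ^ n    ≡⟨ cong (2 ^ n +_) (sym (+-identityʳ (2 ^ n))) ⟩
  2 ^ suc n        ∎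
  where open ≤-Reasoning

2^m≤2^n⇒m≤n : ∀ {a b} → 2 ^ a ≤ 2 ^ b → a ≤ b
2^m≤2^n⇒m≤n {a} {b} 2^a≤2^b with a ≤? b
... | yes a≤b = a≤b
... | no  a≰b = ⊥-elim (<⇒≱ (^-monoʳ-< 2 (s≤s (s≤s z≤n)) (≰⇒> a≰b)) 2^a≤2^b)

2^m<2^n⇒m<n : ∀ {a b} → 2 ^ a < 2 ^ b → a < b
2^m<2^n⇒m<n {a} {b} 2^a<2^b with a <? b
... | yes a<b = a<b
... | no  a≮b = ⊥-elim (<⇒≱ 2^a<2^b (^-monoʳ-≤ 2 (≮⇒≥ a≮b)))

m*m<n*n⇒m<n : ∀ {m n} → m * m < n * n → m < n
m*m<n*n⇒m<n {m} {n} m*m<n*n with m <? n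
... | yes m<n = m<n
... | no  m≮n = ⊥-elim (<⇒≱ m*m<n*n (*-mono-≤ (≮⇒≥ m≮n) (≮⇒≥ m≮n)))

m*m≤n*n⇒m≤n : ∀ {m n} → m * m ≤ n * n → m ≤ n
m*m≤n*n⇒m≤n {m} {n} m*m≤n*n with m ≤? n
... | yes m≤n = m≤n
... | no  m≰n = ⊥-elim (<⇒≱ (*-mono-< (≰⇒> m≰n) (≰⇒> m≰n)) m*m≤n*n)

x*y<z*c⇒y<z : ∀ {x y z c} → x * y < z * c → c ≤ x → y < z
x*y<z*c⇒y<z {x} {y} {z} {c} xy<zc c≤x =
  *-cancelˡ-< x y z (<-≤-trans xy<zc (≤-trans (*-monoʳ-≤ z c≤x) (≤-reflexive (*-comm z x))))

module _ {P : ℕ → Set} (P? : Decidable P) where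

  Least : Set
  Least = ∃ λ e → P e × (∀ {e′} → e′ < e → ¬ P e′)

  private
    search : ∀ k d → (∀ {e′} → e′ < k → ¬ P e′) → P (d + k) → Least
    search k d below Pd+k with P? k
    ... | yes Pk = k , Pk , below
    search k zero    below Pk   | no ¬Pk = ⊥-elim (¬Pk Pk)
    search k (suc d) below Pd+k | no ¬Pk =
      search (suc k) d below′ (subst P (sym (+-suc d k)) Pd+k)
      where
        below′ : ∀ {e′} → e′ < suc k → ¬ P e′
        below′ e′<1+k with m≤n⇒m<n∨m≡n (≤-pred e′<1+k)
        ... | inj₁ e′<k = below e′<k
        ... | inj₂ refl = ¬Pk

  -- Opaque: only the specification is ever used, and unfolding the search inside large goals
  -- makes type checking blow up.
  opaque
    least : ∀ b → P b → Least
    least b Pb = search 0 b (λ ()) (subst P (sym (+-identityʳ b)) Pb)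

prod-cong : ∀ n {f g : ℕ → ℕ} → (∀ {i} → 1 ≤ i → i ≤ n → f i ≡ g i) → prod n f ≡ prod n g
prod-cong zero    f≡g = refl
prod-cong (suc n) f≡g = cong₂ _*_ (prod-cong n (λ 1≤i i≤n → f≡g 1≤i (m≤n⇒m≤1+n i≤n))) (f≡g z<s ≤-refl)

prod-mono-≤ : ∀ n {f g : ℕ → ℕ} → (∀ {i} → 1 ≤ i → i ≤ n → f i ≤ g i) → prod n f ≤ prod n g
prod-mono-≤ zero    f≤g = ≤-refl
prod-mono-≤ (suc n) f≤g = *-mono-≤ (prod-mono-≤ n (λ 1≤i i≤n → f≤g 1≤i (m≤n⇒m≤1+n i≤n))) (f≤g z<s ≤-refl)

prod-const : ∀ n c → prod n (λ _ → c) ≡ c ^ n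
prod-const zero    c = refl
prod-const (suc n) c = trans (cong (_* c) (prod-const n c)) (*-comm (c ^ n) c)

prod-distrib-* : ∀ n f g → prod n (λ i → f i * g i) ≡ prod n f * prod n g
prod-distrib-* zero    f g = refl
prod-distrib-* (suc n) f g = trans (cong (_* (f (suc n) * g (suc n))) (prod-distrib-* n f g))
                                   (interchange (prod n f) (prod n g) (f (suc n)) (g (suc n)))
  where
    interchange : ∀ a b c d → a * b * (c * d) ≡ a * c * (b * d)
    interchange = solve-∀

prod-mono-length : ∀ (f : ℕ → ℕ) → (∀ i → 1 ≤ f i) → ∀ {m n} → m ≤ n → prod m f ≤ prod n f
prod-mono-length f f≥1 {m} {zero}  z≤n = ≤-refl
prod-mono-length f f≥1 {m} {suc n} m≤1+n with m≤n⇒m<n∨m≡n m≤1+n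
... | inj₂ refl = ≤-refl
... | inj₁ m<1+n = ≤-trans (prod-mono-length f f≥1 (≤-pred m<1+n)) (m≤m*n (prod n f) (f (suc n)) {{>-nonZero (f≥1 (suc n))}})

prod-reverse : ∀ n f → prod n (λ i → f (n ∸ i + 1)) ≡ prod n f
prod-reverse zero    f = refl
prod-reverse (suc n) f = begin
  prod (suc n) (λ i → f (suc n ∸ i + 1))  ≡⟨ prod-unfoldˡ n (λ i → f (suc n ∸ i + 1)) ⟩
  f (n + 1) * prod n (λ i → f (n ∸ i + 1)) ≡⟨ cong₂ _*_ (cong f (+-comm n 1)) (prod-reverse n f) ⟩
  f (suc n) * prod n f                     ≡⟨ *-comm (f (suc n)) (prod n f) ⟩
  prod (suc n) f                           ∎
  where
    open ≡-Reasoning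
    prod-unfoldˡ : ∀ n h → prod (suc n) h ≡ h 1 * prod n (h ∘ suc)
    prod-unfoldˡ zero    h = *-comm 1 (h 1)
    prod-unfoldˡ (suc n) h = trans (cong (_* h (2 + n)) (prod-unfoldˡ n h)) (*-assoc (h 1) _ _)

crossing : ∀ (f : ℕ → ℕ) X {a b} → a ≤ b → f a ≤ X → X < f b → ∃ λ n → a ≤ n × n < b × f n ≤ X × X < f (suc n)
crossing f X {a} {zero}  z≤n fa≤X X<fb = ⊥-elim (<⇒≱ X<fb fa≤X)
crossing f X {a} {suc b} a≤1+b fa≤X X<fb with m≤n⇒m<n∨m≡n a≤1+b
... | inj₂ refl = ⊥-elim (<⇒≱ X<fb fa≤X)
... | inj₁ a<1+b with f b ≤? X
...   | yes fb≤X = b , ≤-pred a<1+b , ≤-refl , fb≤X , X<fb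
...   | no  fb≰X with crossing f X (≤-pred a<1+b) fa≤X (≰⇒> fb≰X)
...     | n , a≤n , n<b , fn≤X , X<fn+1 = n , a≤n , m≤n⇒m≤1+n n<b , fn≤X , X<fn+1

^-distribʳ-* : ∀ m n o → (m * n) ^ o ≡ m ^ o * n ^ o
^-distribʳ-* m n zero    = refl
^-distribʳ-* m n (suc o) = trans (cong (m * n *_) (^-distribʳ-* m n o)) (interchange m n (m ^ o) (n ^ o))
  where
    interchange : ∀ a b c d → a * b * (c * d) ≡ a * c * (b * d)
    interchange = solve-∀

-- Counting primes

prime⇒2≤p : ∀ {p} → Prime p → 2 ≤ p
prime⇒2≤p {p} p-prime = nonTrivial⇒n>1 p {{prime⇒nonTrivial p-prime}}

primeCount-suc : ∀ x → primeCount (suc x) ≡ primeCount x + length (filter prime? [ suc x ])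
primeCount-suc x = begin
  length (filter prime? (upTo (2 + x)))                     ≡⟨ cong (length ∘′ filter prime?) (sym (upTo-∷ʳ (suc x))) ⟩
  length (filter prime? (upTo (suc x) ++ [ suc x ]))         ≡⟨ cong length (filter-++ prime? (upTo (suc x)) [ suc x ]) ⟩
  length (filter prime? (upTo (suc x)) ++ filter prime? [ suc x ]) ≡⟨ length-++ (filter prime? (upTo (suc x))) ⟩
  primeCount x + length (filter prime? [ suc x ])           ∎
  where
    open ≡-Reasoning

primeCount-suc-prime : ∀ {x} → Prime (suc x) → primeCount (suc x) ≡ suc (primeCount x)
primeCount-suc-prime {x} p = trans (primeCount-suc x)
  (trans (cong (λ l → primeCount x + length l) (filter-accept prime? p)) (+-comm (primeCount x) 1))

primeCount-suc-¬prime : ∀ {x} → ¬ Prime (suc x) → primeCount (suc x) ≡ primeCount x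
primeCount-suc-¬prime {x} ¬p = trans (primeCount-suc x)
  (trans (cong (λ l → primeCount x + length l) (filter-reject prime? ¬p)) (+-identityʳ (primeCount x)))

primeCount-mono-≤ : ∀ {x y} → x ≤ y → primeCount x ≤ primeCount y
primeCount-mono-≤ {x} {zero}  z≤n = ≤-refl
primeCount-mono-≤ {x} {suc y} x≤1+y with m≤n⇒m<n∨m≡n x≤1+y
... | inj₂ refl = ≤-refl
... | inj₁ x<1+y with prime? (suc y)
...   | yes p  = ≤-trans (primeCount-mono-≤ (≤-pred x<1+y)) (≤-trans (n≤1+n _) (≤-reflexive (sym (primeCount-suc-prime p))))
...   | no  ¬p = ≤-trans (primeCount-mono-≤ (≤-pred x<1+y)) (≤-reflexive (sym (primeCount-suc-¬prime ¬p)))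

primeCount≤1+x : ∀ x → primeCount x ≤ suc x
primeCount≤1+x x = ≤-trans (length-filter prime? (upTo (suc x))) (≤-reflexive (length-upTo (suc x)))

primeCount-mono-< : ∀ {x q} → Prime q → x < q → primeCount x < primeCount q
primeCount-mono-< {x} {suc q} q-prime (s≤s x≤q) =
  subst (primeCount x <_) (sym (primeCount-suc-prime q-prime)) (s≤s (primeCount-mono-≤ x≤q))

IsNthPrime-unique : ∀ {k p q} → IsNthPrime k p → IsNthPrime k q → p ≡ q
IsNthPrime-unique {k} {p} {q} (p-prime , πp≡k) (q-prime , πq≡k) with <-cmp p q
... | tri< p<q _ _ = ⊥-elim (<-irrefl (trans πp≡k (sym πq≡k)) (primeCount-mono-< q-prime p<q))
... | tri≈ _ p≡q _ = p≡q
... | tri> _ _ q<p = ⊥-elim (<-irrefl (trans πq≡k (sym πp≡k)) (primeCount-mono-< p-prime q<p))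

-- The least x ≤ y with k ≤ primeCount x; a junk value when k > primeCount y.
nthPrimeUpTo : ℕ → ℕ → ℕ
nthPrimeUpTo zero    k = 0
nthPrimeUpTo (suc y) k with k ≤? primeCount y
... | yes _ = nthPrimeUpTo y k
... | no  _ = suc y

nthPrimeUpTo-correct : ∀ y {k} → 1 ≤ k → k ≤ primeCount y → nthPrimeUpTo y k ≤ y × IsNthPrime k (nthPrimeUpTo y k)
nthPrimeUpTo-correct zero    1≤k k≤0 = ⊥-elim (<⇒≱ 1≤k k≤0)
nthPrimeUpTo-correct (suc y) {k} 1≤k k≤π with k ≤? primeCount y
... | yes k≤πy = map₁ m≤n⇒m≤1+n (nthPrimeUpTo-correct y 1≤k k≤πy)
... | no  k≰πy with prime? (suc y)
...   | yes p  = ≤-refl , p , ≤-antisym (≤-trans (≤-reflexive (primeCount-suc-prime p)) (≰⇒> k≰πy)) k≤π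
...   | no  ¬p = ⊥-elim (k≰πy (≤-trans k≤π (≤-reflexive (primeCount-suc-¬prime ¬p))))

-- Chebyshev's bound

split-power : ∀ {q} → 1 < q → ∀ n → 0 < n → ∃₂ λ k n′ → n ≡ q ^ k * n′ × ¬ q ∣ n′
split-power {q} 1<q = <-rec _ split
  where
    split : ∀ n → (∀ {m} → m < n → 0 < m → ∃₂ λ k n′ → m ≡ q ^ k * n′ × ¬ q ∣ n′)
          → 0 < n → ∃₂ λ k n′ → n ≡ q ^ k * n′ × ¬ q ∣ n′
    split n rec 0<n with q ∣? n
    ... | no  q∤n = 0 , n , sym (+-identityʳ n) , q∤n
    ... | yes (divides zero n≡0) = ⊥-elim (<-irrefl (sym n≡0) 0<n)
    ... | yes (divides m@(suc _) n≡mq) with rec (subst (m <_) (sym n≡mq) (m<m*n m q 1<q)) z<s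
    ...   | k , n′ , m≡ , q∤n′ = suc k , n′ , n≡ , q∤n′
      where
        n≡ : n ≡ q ^ suc k * n′
        n≡ = begin
          n               ≡⟨ n≡mq ⟩
          m * q           ≡⟨ cong (_* q) m≡ ⟩
          q ^ k * n′ * q  ≡⟨ reorder (q ^ k) n′ q ⟩
          q * q ^ k * n′  ∎
          where
            open ≡-Reasoning
            reorder : ∀ a b c → a * b * c ≡ c * a * b
            reorder = solve-∀

≤^primeCount : ∀ y {X n} → 0 < n
             → (∀ {p} j → Prime p → p ^ j ∣ n → p ^ j ≤ X)
             → (∀ {p} → Prime p → p ∣ n → p ≤ y)
             → n ≤ X ^ primeCount y
≤^primeCount zero {X} {n} 0<n _ factors≤0 with factorise n {{>-nonZero 0<n}}
... | record { factors = [] ; isFactorisation = n≡1 } = ≤-reflexive n≡1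
... | record { factors = p ∷ ps ; isFactorisation = n≡ ; factorsPrime = p-prime ∷ _ } =
  ⊥-elim (<⇒≱ (prime⇒2≤p p-prime) (≤-trans (factors≤0 p-prime (subst (p ∣_) (sym n≡) (m∣m*n (product ps)))) z≤n))
≤^primeCount (suc y) {X} {n} 0<n powers≤X factors≤1+y with prime? (suc y)
... | no ¬prime = subst (λ k → n ≤ X ^ k) (sym (primeCount-suc-¬prime ¬prime))
                    (≤^primeCount y 0<n powers≤X factors≤y)
  where
    factors≤y : ∀ {p} → Prime p → p ∣ n → p ≤ y
    factors≤y p-prime p∣n with m≤n⇒m<n∨m≡n (factors≤1+y p-prime p∣n)
    ... | inj₁ p<1+y = ≤-pred p<1+y
    ... | inj₂ refl  = ⊥-elim (¬prime p-prime)
... | yes 1+y-prime with split-power (prime⇒2≤p 1+y-prime) n 0<n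
...   | k , n′ , n≡ , 1+y∤n′ = subst (λ k → n ≤ X ^ k) (sym (primeCount-suc-prime 1+y-prime)) (begin
        n                               ≡⟨ n≡ ⟩
        suc y ^ k * n′                  ≤⟨ *-mono-≤ (powers≤X k 1+y-prime (subst (suc y ^ k ∣_) (sym n≡) (m∣m*n n′))) n′≤ ⟩
        X * X ^ primeCount y            ∎)
  where
    open ≤-Reasoning
    n′∣n : n′ ∣ n
    n′∣n = subst (n′ ∣_) (sym n≡) (n∣m*n (suc y ^ k))
    0<n′ : 0 < n′
    0<n′ = >-nonZero⁻¹ n′ {{m*n≢0⇒n≢0 (suc y ^ k) {{subst NonZero n≡ (>-nonZero 0<n)}}}}
    factors≤y : ∀ {p} → Prime p → p ∣ n′ → p ≤ y
    factors≤y p-prime p∣n′ with m≤n⇒m<n∨m≡n (factors≤1+y p-prime (∣-trans p∣n′ n′∣n))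
    ... | inj₁ p<1+y = ≤-pred p<1+y
    ... | inj₂ refl  = ⊥-elim (1+y∤n′ p∣n′)
    n′≤ : n′ ≤ X ^ primeCount y
    n′≤ = ≤^primeCount y 0<n′ (λ j p-prime d → powers≤X j p-prime (∣-trans d n′∣n)) factors≤y

centralBinomial : ℕ → ℕ
centralBinomial m = (m + m) C m

factorial≡centralBinomial*m!² : ∀ m → (m + m) ! ≡ centralBinomial m * (m ! * m !)
factorial≡centralBinomial*m!² m = sym (begin
  centralBinomial m * (m ! * m !)            ≡⟨ cong (_* (m ! * m !)) C≡ ⟩
  (m + m) ! / (m ! * m !) * (m ! * m !)      ≡⟨ m/n*n≡m m!²∣ ⟩
  (m + m) !                                  ∎)
  where
    open ≡-Reasoning
    instance
      m!²≢0 : NonZero (m ! * m !)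
      m!²≢0 = m !* m !≢0
    m!²∣ : m ! * m ! ∣ (m + m) !
    m!²∣ = subst (λ k → m ! * k ! ∣ (m + m) !) (m+n∸m≡n m m) (k![n∸k]!∣n! (m≤m+n m m))
    C≡ : (m + m) C m ≡ (m + m) ! / (m ! * m !)
    C≡ = trans (nCk≡n!/k![n-k]! (m≤m+n m m))
               (/-congʳ {{m !* (m + m ∸ m) !≢0}} (cong (λ k → m ! * k !) (m+n∸m≡n m m)))

0<centralBinomial : ∀ m → 0 < centralBinomial m
0<centralBinomial m =
  >-nonZero⁻¹ _ {{m*n≢0⇒m≢0 (centralBinomial m) {{subst NonZero (factorial≡centralBinomial*m!² m) ((m + m) !≢0)}}}}

centralBinomial-suc : ∀ m → centralBinomial (suc m) * suc m ≡ 2 * suc (m + m) * centralBinomial m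
centralBinomial-suc m = *-cancelʳ-≡ _ _ (suc m * (m ! * m !)) {{m*n≢0 (suc m) (m ! * m !) {{_}} {{m !* m !≢0}}}} (begin
  centralBinomial (suc m) * suc m * (suc m * (m ! * m !))  ≡⟨ regroupˡ (centralBinomial (suc m)) m (m !) ⟩
  centralBinomial (suc m) * (suc m ! * suc m !)            ≡⟨ sym (factorial≡centralBinomial*m!² (suc m)) ⟩
  (suc m + suc m) !                                        ≡⟨ cong _! (+-suc (suc m) m) ⟩
  (2 + m + m) * ((1 + m + m) * (m + m) !)                  ≡⟨ cong (λ x → (2 + m + m) * ((1 + m + m) * x)) (factorial≡centralBinomial*m!² m) ⟩
  (2 + m + m) * ((1 + m + m) * (centralBinomial m * (m ! * m !))) ≡⟨ regroupʳ m (centralBinomial m) (m !) ⟩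
  2 * suc (m + m) * centralBinomial m * (suc m * (m ! * m !)) ∎)
  where
    open ≡-Reasoning
    regroupˡ : ∀ c m f → c * suc m * (suc m * (f * f)) ≡ c * (suc m * f * (suc m * f))
    regroupˡ = solve-∀
    regroupʳ : ∀ m c f → (2 + m + m) * ((1 + m + m) * (c * (f * f))) ≡ 2 * suc (m + m) * c * (suc m * (f * f))
    regroupʳ = solve-∀

4^m≤[1+2m]*centralBinomial : ∀ m → 2 ^ (m + m) ≤ suc (m + m) * centralBinomial m
4^m≤[1+2m]*centralBinomial zero    = z<s
4^m≤[1+2m]*centralBinomial (suc m) = *-cancelˡ-≤ (suc m) (begin
  suc m * 2 ^ (suc m + suc m)                           ≡⟨ cong (λ k → suc m * 2 ^ k) (+-suc (suc m) m) ⟩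
  suc m * (2 * (2 * 2 ^ (m + m)))                       ≤⟨ m≤m+n _ (2 * 2 ^ (m + m)) ⟩
  suc m * (2 * (2 * 2 ^ (m + m))) + 2 * 2 ^ (m + m)     ≡⟨ collect m (2 ^ (m + m)) ⟩
  2 * (3 + m + m) * 2 ^ (m + m)                         ≤⟨ *-monoʳ-≤ (2 * (3 + m + m)) (4^m≤[1+2m]*centralBinomial m) ⟩
  2 * (3 + m + m) * (suc (m + m) * centralBinomial m)   ≡⟨ regroup m (centralBinomial m) ⟩
  (3 + m + m) * (2 * suc (m + m) * centralBinomial m)   ≡⟨ cong ((3 + m + m) *_) (sym (centralBinomial-suc m)) ⟩
  (3 + m + m) * (centralBinomial (suc m) * suc m)       ≡⟨ commute m (centralBinomial (suc m)) ⟩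
  suc m * (suc (suc m + suc m) * centralBinomial (suc m)) ∎)
  where
    open ≤-Reasoning
    collect : ∀ m x → suc m * (2 * (2 * x)) + 2 * x ≡ 2 * (3 + m + m) * x
    collect = solve-∀
    regroup : ∀ m c → 2 * (3 + m + m) * (suc (m + m) * c) ≡ (3 + m + m) * (2 * suc (m + m) * c)
    regroup = solve-∀
    commute : ∀ m c → (3 + m + m) * (c * suc m) ≡ suc m * (suc (suc m + suc m) * c)
    commute = solve-∀

module Legendre {p′} (p-prime : Prime (suc p′)) where

  private
    p : ℕ
    p = suc p′

  p∤-* : ∀ {a b} → ¬ p ∣ a → ¬ p ∣ b → ¬ p ∣ a * b
  p∤-* {a} {b} p∤a p∤b p∣ab with euclidsLemma a b p-prime p∣ab
  ... | inj₁ p∣a = p∤a p∣a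
  ... | inj₂ p∣b = p∤b p∣b

  p∤1+r : ∀ {r} → suc r < p → ¬ p ∣ suc r
  p∤1+r 1+r<p p∣1+r = <⇒≱ 1+r<p (∣⇒≤ p∣1+r)

  -- ν T n = ⌊n/p⌋ + ⌊n/p²⌋ + ⋯ + ⌊n/p^T⌋
  ν : ℕ → ℕ → ℕ
  ν zero    n = 0
  ν (suc T) n = n / p + ν T (n / p)

  factorial-split : ∀ q r → r < p → ∃ λ u → ¬ p ∣ u × (r + q * p) ! ≡ p ^ q * q ! * u
  factorial-split zero    zero    _ = 1 , p∤1+r (prime⇒2≤p p-prime) , refl
  factorial-split (suc q) zero    _ with factorial-split q p′ ≤-refl
  ... | u , p∤u , eq = u , p∤u , trans (cong (suc q * p *_) eq) (regroup p q (p ^ q) (q !) u)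
    where
      regroup : ∀ p q x f u → suc q * p * (x * f * u) ≡ p * x * (suc q * f) * u
      regroup = solve-∀
  factorial-split q       (suc r) 1+r<p with factorial-split q r (<⇒≤ 1+r<p)
  ... | u , p∤u , eq = suc (r + q * p) * u , p∤-* p∤1+r+qp p∤u ,
                       trans (cong (suc (r + q * p) *_) eq) (regroup (suc (r + q * p)) (p ^ q) (q !) u)
    where
      regroup : ∀ a x f u → a * (x * f * u) ≡ x * f * (a * u)
      regroup = solve-∀
      p∤1+r+qp : ¬ p ∣ suc r + q * p
      p∤1+r+qp p∣ = p∤1+r 1+r<p (∣m+n∣m⇒∣n (subst (p ∣_) (+-comm (suc r) (q * p)) p∣) (n∣m*n q))

  factorial-valuation : ∀ T n → n < p ^ suc T → ∃ λ w → ¬ p ∣ w × n ! ≡ p ^ ν T n * w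
  factorial-valuation zero    n n<p with factorial-split 0 n (subst (n <_) (*-identityʳ p) n<p)
  ... | u , p∤u , eq = u , p∤u , subst (λ k → k ! ≡ 1 * u) (+-identityʳ n) eq
  factorial-valuation (suc T) n n<p^T+2
    with factorial-split (n / p) (n % p) (m%n<n n p)
       | factorial-valuation T (n / p) (m<n*o⇒m/o<n (subst (n <_) (*-comm p (p ^ suc T)) n<p^T+2))
  ... | u , p∤u , eq | w , p∤w , eq′ = w * u , p∤-* p∤w p∤u , (begin
    n !                                        ≡⟨ cong _! (m≡m%n+[m/n]*n n p) ⟩
    (n % p + n / p * p) !                      ≡⟨ eq ⟩
    p ^ (n / p) * (n / p) ! * u                ≡⟨ cong (λ x → p ^ (n / p) * x * u) eq′ ⟩
    p ^ (n / p) * (p ^ ν T (n / p) * w) * u    ≡⟨ regroup (p ^ (n / p)) (p ^ ν T (n / p)) w u ⟩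
    p ^ (n / p) * p ^ ν T (n / p) * (w * u)    ≡⟨ cong (_* (w * u)) (sym (^-distribˡ-+-* p (n / p) _)) ⟩
    p ^ ν (suc T) n * (w * u)                  ∎)
    where
      open ≡-Reasoning
      regroup : ∀ a b w u → a * (b * w) * u ≡ a * b * (w * u)
      regroup = solve-∀

  p^a∣p^b*w⇒a≤b : ∀ a b {w} → ¬ p ∣ w → p ^ a ∣ p ^ b * w → a ≤ b
  p^a∣p^b*w⇒a≤b zero    b       p∤w _ = z≤n
  p^a∣p^b*w⇒a≤b (suc a) zero    {w} p∤w p^a+1∣w =
    ⊥-elim (p∤w (∣-trans (m∣m*n (p ^ a)) (subst (p ^ suc a ∣_) (+-identityʳ w) p^a+1∣w)))
  p^a∣p^b*w⇒a≤b (suc a) (suc b) {w} p∤w p^a+1∣ =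
    s≤s (p^a∣p^b*w⇒a≤b a b p∤w (*-cancelˡ-∣ p (subst (p * p ^ a ∣_) (*-assoc p (p ^ b) w) p^a+1∣)))

  carry : ∀ m c → (m + m + c) / p ≡ m / p + m / p + (m % p + m % p + c) / p
  carry m c = begin
    (m + m + c) / p                                      ≡⟨ /-congˡ (trans (cong (λ x → x + x + c) (m≡m%n+[m/n]*n m p)) (regroup (m % p) (m / p) p c)) ⟩
    ((m % p + m % p + c) + (m / p + m / p) * p) / p      ≡⟨ +-distrib-/-∣ʳ (m % p + m % p + c) (n∣m*n (m / p + m / p)) ⟩
    (m % p + m % p + c) / p + (m / p + m / p) * p / p    ≡⟨ cong ((m % p + m % p + c) / p +_) (m*n/n≡m (m / p + m / p) p) ⟩
    (m % p + m % p + c) / p + (m / p + m / p)            ≡⟨ +-comm _ (m / p + m / p) ⟩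
    m / p + m / p + (m % p + m % p + c) / p              ∎
    where
      open ≡-Reasoning
      regroup : ∀ r q p c → (r + q * p) + (r + q * p) + c ≡ (r + r + c) + (q + q) * p
      regroup = solve-∀

  carry≤1 : ∀ m {c} → c ≤ 1 → (m % p + m % p + c) / p ≤ 1
  carry≤1 m {c} c≤1 = ≤-pred (m<n*o⇒m/o<n (begin-strict
    m % p + m % p + c       ≤⟨ +-mono-≤ (+-mono-≤ r≤p′ r≤p′) c≤1 ⟩
    p′ + p′ + 1             <⟨ n<1+n _ ⟩
    suc (p′ + p′ + 1)       ≡⟨ double p′ ⟩
    2 * p                   ∎))
    where
      open ≤-Reasoning
      r≤p′ : m % p ≤ p′
      r≤p′ = ≤-pred (m%n<n m p)
      double : ∀ p′ → suc (p′ + p′ + 1) ≡ 2 * suc p′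
      double = solve-∀

  carry-bound : ∀ {k D x M} → k ≤ 1 → k ≤ x → x * p ≤ M → p ^ D ≤ x ⊔ 1 → p ^ (k + D) ≤ M ⊔ 1
  carry-bound {zero}  {D} {x} {M} _ _   xp≤M p^D≤ =
    ≤-trans p^D≤ (⊔-monoˡ-≤ 1 (≤-trans (m≤m*n x p) xp≤M))
  carry-bound {suc zero} {D} {x} {M} _ 1≤x xp≤M p^D≤ = begin
    p * p ^ D      ≤⟨ *-monoʳ-≤ p (≤-trans p^D≤ (≤-reflexive (m≥n⇒m⊔n≡m 1≤x))) ⟩
    p * x          ≡⟨ *-comm p x ⟩
    x * p          ≤⟨ xp≤M ⟩
    M              ≤⟨ m≤m⊔n M 1 ⟩
    M ⊔ 1          ∎
    where open ≤-Reasoning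
  carry-bound {2+ _} (s≤s ())

  -- ν T (m + m + c) − 2 ν T m counts the carries when doubling m (plus c) in base p, and a carry
  -- into digit i needs p ^ i ≤ m + m + c.
  ν-central : ∀ T m {c} → c ≤ 1 → ∃ λ D → ν T (m + m + c) ≤ ν T m + ν T m + D × p ^ D ≤ (m + m + c) ⊔ 1
  ν-central zero    m c≤1 = 0 , z≤n , m≤n⊔m (m + m + _) 1
  ν-central (suc T) m {c} c≤1 with ν-central T (m / p) (carry≤1 m c≤1)
  ... | D , ν≤ , p^D≤ = c′ + D , ν-step ,
        carry-bound (carry≤1 m c≤1) (m≤n+m c′ (a + a)) (subst (λ y → y * p ≤ m + m + c) x≡ (m/n*n≤m _ p)) p^D≤
    where
      open ≤-Reasoning
      a  = m / p
      c′ = (m % p + m % p + c) / p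
      x  = (m + m + c) / p
      x≡ : x ≡ a + a + c′
      x≡ = carry m c
      ν-step : ν (suc T) (m + m + c) ≤ ν (suc T) m + ν (suc T) m + (c′ + D)
      ν-step = begin
        x + ν T x                                ≡⟨ cong (λ y → y + ν T y) x≡ ⟩
        (a + a + c′) + ν T (a + a + c′)          ≤⟨ +-monoʳ-≤ (a + a + c′) ν≤ ⟩
        (a + a + c′) + (ν T a + ν T a + D)       ≡⟨ regroup a c′ (ν T a) D ⟩
        (a + ν T a) + (a + ν T a) + (c′ + D)     ∎
        where
          regroup : ∀ a c′ v D → (a + a + c′) + (v + v + D) ≡ (a + v) + (a + v) + (c′ + D)
          regroup = solve-∀

  n<p^1+n : ∀ n → n < p ^ suc n
  n<p^1+n n = <-≤-trans (n<2^n n) (≤-trans (^-monoʳ-≤ 2 (n≤1+n n)) (^-monoˡ-≤ (suc n) (prime⇒2≤p p-prime)))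

  prime-power∣centralBinomial⇒≤ : ∀ {m} j → 1 ≤ m → p ^ j ∣ centralBinomial m → p ^ j ≤ m + m
  prime-power∣centralBinomial⇒≤ {m} j 1≤m p^j∣C
    with factorial-valuation (m + m) (m + m) (n<p^1+n (m + m))
       | factorial-valuation (m + m) m (≤-trans (s≤s (m≤m+n m m)) (n<p^1+n (m + m)))
       | ν-central (m + m) m {0} z≤n
  ... | w , p∤w , [2m]!≡ | w′ , _ , m!≡ | D , ν≤ , p^D≤ = begin
    p ^ j             ≤⟨ ^-monoʳ-≤ p j≤D ⟩
    p ^ D             ≤⟨ subst (λ y → p ^ D ≤ y ⊔ 1) (+-identityʳ (m + m)) p^D≤ ⟩
    (m + m) ⊔ 1       ≡⟨ m≥n⇒m⊔n≡m (≤-trans 1≤m (m≤m+n m m)) ⟩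
    m + m             ∎
    where
      open ≤-Reasoning
      νm = ν (m + m) m
      p^νm∣m! : p ^ νm ∣ m !
      p^νm∣m! = subst (p ^ νm ∣_) (sym m!≡) (m∣m*n w′)
      divides-[2m]! : p ^ (j + νm + νm) ∣ p ^ ν (m + m) (m + m) * w
      divides-[2m]! = subst₂ _∣_
        (sym (trans (^-distribˡ-+-* p (j + νm) νm)
                    (trans (cong (_* p ^ νm) (^-distribˡ-+-* p j νm)) (*-assoc (p ^ j) _ _))))
        (trans (sym (factorial≡centralBinomial*m!² m)) [2m]!≡)
        (*-pres-∣ p^j∣C (*-pres-∣ p^νm∣m! p^νm∣m!))
      j≤D : j ≤ D
      j≤D = +-cancelʳ-≤ (νm + νm) j D (begin
        j + (νm + νm)                   ≡⟨ sym (+-assoc j νm νm) ⟩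
        j + νm + νm                     ≤⟨ p^a∣p^b*w⇒a≤b _ _ p∤w divides-[2m]! ⟩
        ν (m + m) (m + m)               ≡⟨ cong (ν (m + m)) (sym (+-identityʳ (m + m))) ⟩
        ν (m + m) (m + m + 0)           ≤⟨ ν≤ ⟩
        νm + νm + D                     ≡⟨ +-comm (νm + νm) D ⟩
        D + (νm + νm)                   ∎)

chebyshev : ∀ m → 1 ≤ m → 2 ^ (m + m) ≤ suc (m + m) ^ suc (primeCount (m + m))
chebyshev m 1≤m = begin
  2 ^ (m + m)                                      ≤⟨ 4^m≤[1+2m]*centralBinomial m ⟩
  suc (m + m) * centralBinomial m                  ≤⟨ *-monoʳ-≤ (suc (m + m)) C≤ ⟩
  suc (m + m) * (m + m) ^ primeCount (m + m)       ≤⟨ *-monoʳ-≤ (suc (m + m)) (^-monoˡ-≤ (primeCount (m + m)) (n≤1+n (m + m))) ⟩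
  suc (m + m) ^ suc (primeCount (m + m))           ∎
  where
    open ≤-Reasoning
    powers≤ : ∀ {p} j → Prime p → p ^ j ∣ centralBinomial m → p ^ j ≤ m + m
    powers≤ {suc _} j p-prime = Legendre.prime-power∣centralBinomial⇒≤ p-prime j 1≤m
    factors≤ : ∀ {p} → Prime p → p ∣ centralBinomial m → p ≤ m + m
    factors≤ {p} p-prime p∣C =
      subst (_≤ m + m) (*-identityʳ p) (powers≤ 1 p-prime (subst (_∣ centralBinomial m) (sym (*-identityʳ p)) p∣C))
    C≤ : centralBinomial m ≤ (m + m) ^ primeCount (m + m)
    C≤ = ≤^primeCount (m + m) (0<centralBinomial m) powers≤ factors≤

-- Ladders of Φ-values

Φpp-1 : ∀ p → Φpp p 1 ≡ suc p
Φpp-1 p = trans (*-identityˡ (p + 1)) (+-comm p 1)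

Φpp-suc : ∀ p e → Φpp p (2 + e) ≡ p * Φpp p (suc e)
Φpp-suc p e = *-assoc p (p ^ e) (p + 1)

Φpp-+ : ∀ p e j → Φpp p (suc e + j) ≡ Φpp p (suc e) * p ^ j
Φpp-+ p e j = trans (cong (_* (p + 1)) (^-distribˡ-+-* p e j)) (exchange (p ^ e) (p ^ j) (p + 1))
  where
    exchange : ∀ a b c → a * b * c ≡ a * c * b
    exchange = solve-∀

p<Φpp : ∀ p e → 1 ≤ p → p < Φpp p (suc e)
p<Φpp p e 1≤p = begin-strict
  p                  <⟨ m<m+n p z<s ⟩
  p + 1              ≡⟨ sym (*-identityˡ (p + 1)) ⟩
  1 * (p + 1)        ≤⟨ *-monoˡ-≤ (p + 1) (m^n>0 p {{>-nonZero 1≤p}} e) ⟩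
  p ^ e * (p + 1)    ∎
  where open ≤-Reasoning

e≤Φpp : ∀ p e → 2 ≤ p → e ≤ Φpp p (suc e)
e≤Φpp p e 2≤p = ≤-trans (<⇒≤ (n<2^n e)) (≤-trans (^-monoˡ-≤ e 2≤p) (m≤m*n (p ^ e) (p + 1) {{>-nonZero (m≤n+m 1 p)}}))

-- The values Φ(p^(1+e+j)) = m·p^j, j ≤ r, of powers of p = 2 + p″ that lie in the window [s, K).
module Dial {s K : ℕ} (2≤s : 2 ≤ s) (s-small : (s ∸ 2) * (s ∸ 1) < K) (p″ : ℕ) where

  p : ℕ
  p = 2 + p″

  private
    2≤p : 2 ≤ p
    2≤p = s≤s (s≤s z≤n)

    least-e : Least (λ e → s ≤? Φpp p (suc e))
    least-e = least (λ e → s ≤? Φpp p (suc e)) s (e≤Φpp p s 2≤p)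

  e : ℕ
  e = proj₁ least-e

  m : ℕ
  m = Φpp p (suc e)

  s≤m : s ≤ m
  s≤m = proj₁ (proj₂ least-e)

  private
    minimal-Φ<p*s : ∀ e → (∀ {e′} → e′ < e → ¬ s ≤ Φpp p (suc e′)) → Φpp p (suc e) < p * s
    minimal-Φ<p*s zero     _     = begin-strict
      Φpp p 1   ≡⟨ Φpp-1 p ⟩
      suc p     <⟨ +-monoˡ-< p 2≤p ⟩
      p + p     ≡⟨ cong (p +_) (sym (+-identityʳ p)) ⟩
      2 * p     ≤⟨ *-monoˡ-≤ p 2≤s ⟩
      s * p     ≡⟨ *-comm s p ⟩
      p * s     ∎
      where open ≤-Reasoning
    minimal-Φ<p*s (suc e′) below = subst (_< p * s) (sym (Φpp-suc p e′)) (*-monoʳ-< p (≰⇒> (below ≤-refl)))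

    minimal-Φ<K : ∀ e → (∀ {e′} → e′ < e → ¬ s ≤ Φpp p (suc e′)) → suc p < K → Φpp p (suc e) < K
    minimal-Φ<K zero     _     1+p<K = subst (_< K) (sym (Φpp-1 p)) 1+p<K
    minimal-Φ<K (suc e′) below _     = begin-strict
      Φpp p (2 + e′)         ≡⟨ Φpp-suc p e′ ⟩
      p * φ                  ≤⟨ *-mono-≤ (∸-monoˡ-≤ 2 (≤-trans (s≤s (p<Φpp p e′ (<⇒≤ 2≤p))) φ<s)) (∸-monoˡ-≤ 1 φ<s) ⟩
      (s ∸ 2) * (s ∸ 1)      <⟨ s-small ⟩
      K                      ∎
      where
        open ≤-Reasoning
        φ = Φpp p (suc e′)
        φ<s : φ < s
        φ<s = ≰⇒> (below ≤-refl)

  m<p*s : m < p * s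
  m<p*s = minimal-Φ<p*s e (proj₂ (proj₂ least-e))

  private
    0<m : 0 < m
    0<m = <-≤-trans (s≤s z≤n) (<⇒≤ (p<Φpp p e (<⇒≤ 2≤p)))

    least-r : Least (λ i → K ≤? m * p ^ suc i)
    least-r = least (λ i → K ≤? m * p ^ suc i) K (begin
      K                  ≤⟨ <⇒≤ (n<2^n K) ⟩
      2 ^ K              ≤⟨ ^-monoˡ-≤ K 2≤p ⟩
      p ^ K              ≤⟨ ^-monoʳ-≤ p (n≤1+n K) ⟩
      p ^ suc K          ≤⟨ m≤n*m (p ^ suc K) m {{>-nonZero 0<m}} ⟩
      m * p ^ suc K      ∎)
      where open ≤-Reasoning

  r : ℕ
  r = proj₁ least-r

  K≤m*p^[1+r] : K ≤ m * p ^ suc r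
  K≤m*p^[1+r] = proj₁ (proj₂ least-r)

  K<p^r*[p*p*s] : K < p ^ r * (p * p * s)
  K<p^r*[p*p*s] = begin-strict
    K                      ≤⟨ K≤m*p^[1+r] ⟩
    m * (p * p ^ r)        <⟨ *-monoˡ-< (p * p ^ r) {{m^n≢0 p (suc r)}} m<p*s ⟩
    p * s * (p * p ^ r)    ≡⟨ regroup p s (p ^ r) ⟩
    p ^ r * (p * p * s)    ∎
    where
      open ≤-Reasoning
      regroup : ∀ p s x → p * s * (p * x) ≡ x * (p * p * s)
      regroup = solve-∀

  module _ (1+p<K : suc p < K) where

    private
      top<K : ∀ r → (∀ {i} → i < r → ¬ K ≤ m * p ^ suc i) → m * p ^ r < K
      top<K zero     _     = subst (_< K) (sym (*-identityʳ m)) (minimal-Φ<K e (proj₂ (proj₂ least-e)) 1+p<K)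
      top<K (suc r′) below = ≰⇒> (below ≤-refl)

    m*p^r<K : m * p ^ r < K
    m*p^r<K = top<K r (proj₂ (proj₂ least-r))

    window : ∀ {j} → j ≤ r → s ≤ m * p ^ j × m * p ^ j < K
    window {j} j≤r = ≤-trans s≤m (m≤m*n m (p ^ j) {{m^n≢0 p j}}) , ≤-<-trans (*-monoʳ-≤ m (^-monoʳ-≤ p j≤r)) m*p^r<K

    0<r⇒p*p<K : 0 < r → p * p < K
    0<r⇒p*p<K 0<r = begin-strict
      p * p         <⟨ *-monoʳ-< p (p<Φpp p e (<⇒≤ 2≤p)) ⟩
      p * m         ≡⟨ trans (*-comm p m) (cong (m *_) (sym (*-identityʳ p))) ⟩
      m * p ^ 1     ≤⟨ *-monoʳ-≤ m (^-monoʳ-≤ p 0<r) ⟩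
      m * p ^ r     <⟨ m*p^r<K ⟩
      K             ∎
      where open ≤-Reasoning

-- Greedy covering

_[_≔_] : (ℕ → ℕ) → ℕ → ℕ → ℕ → ℕ
(f [ k ≔ x ]) i with i ≟ k
... | yes _ = x
... | no  _ = f i

[≔]-≡ : ∀ f k x → (f [ k ≔ x ]) k ≡ x
[≔]-≡ f k x with k ≟ k
... | yes _   = refl
... | no  k≢k = ⊥-elim (k≢k refl)

[≔]-≢ : ∀ f {k} x {i} → i ≢ k → (f [ k ≔ x ]) i ≡ f i
[≔]-≢ f {k} x {i} i≢k with i ≟ k
... | yes i≡k = ⊥-elim (i≢k i≡k)
... | no  _   = refl

[≔]-≤ : ∀ {f g : ℕ → ℕ} {k x} → (∀ i → f i ≤ g i) → x ≤ g k → ∀ i → (f [ k ≔ x ]) i ≤ g i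
[≔]-≤ {k = k} f≤g x≤ i with i ≟ k
... | yes refl = x≤
... | no  _    = f≤g i

highest-rung : ∀ A X q r → A ≤ X → ∃ λ j → j ≤ r × A * q ^ j ≤ X × (j ≡ r ⊎ (j < r × X < A * q ^ suc j))
highest-rung A X q zero    A≤X = 0 , z≤n , subst (_≤ X) (sym (*-identityʳ A)) A≤X , inj₁ refl
highest-rung A X q (suc r) A≤X with highest-rung A X q r A≤X
... | j , j≤r , ≤X , inj₂ (j<r , X<) = j , m≤n⇒m≤1+n j≤r , ≤X , inj₂ (m≤n⇒m≤1+n j<r , X<)
... | j , j≤r , ≤X , inj₁ refl with A * q ^ suc r ≤? X
...   | yes ≤X′ = suc r , ≤-refl , ≤X′ , inj₁ refl
...   | no  X<  = r , n≤1+n r , ≤X , inj₂ (≤-refl , ≰⇒> X<)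

-- Exponents are chosen greedily from the top index down; SmallSteps says that one step of the
-- ladder at index i + 1 is at most c times the range W i of all the ladders below it.
module Covering (m q r : ℕ → ℕ) (0<m : ∀ i → 0 < m i) (0<q : ∀ i → 0 < q i) (c : ℕ) where

  rung : ℕ → ℕ → ℕ
  rung i k = m i * q i ^ k

  value : (ℕ → ℕ) → ℕ → ℕ
  value j i = rung i (j i)

  lo W hi : ℕ → ℕ
  lo n = prod n m
  W  n = prod n (λ i → q i ^ r i)
  hi n = prod n (value r)

  hi≡lo*W : ∀ n → hi n ≡ lo n * W n
  hi≡lo*W n = prod-distrib-* n m (λ i → q i ^ r i)

  rung≢0 : ∀ i k → NonZero (rung i k)
  rung≢0 i k = >-nonZero (*-mono-≤ (0<m i) (m^n>0 (q i) {{>-nonZero (0<q i)}} k))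

  SmallSteps : ℕ → Set
  SmallSteps n = ∀ i → i < n → 0 < r (suc i) → q (suc i) ≤ c * W i

  Covers : ℕ → ℕ → Set
  Covers n X = ∃ λ j → (∀ i → j i ≤ r i) × prod n (value j) ≤ X × X < c * prod n (value j)

  private
    put-on-top : ∀ n X jj → jj ≤ r (suc n) → let instance _ = rung≢0 (suc n) jj in
                 Covers n (X / rung (suc n) jj) → Covers (suc n) X
    put-on-top n X jj jj≤r (j , j≤r , prod≤ , <cprod) = j′ , j′≤r , prod≤X , X<cprod
      where
        open ≤-Reasoning
        v = rung (suc n) jj
        instance _ = rung≢0 (suc n) jj
        j′ = j [ suc n ≔ jj ]
        j′≤r : ∀ i → j′ i ≤ r i
        j′≤r = [≔]-≤ j≤r jj≤r
        prod≡ : prod (suc n) (value j′) ≡ prod n (value j) * v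
        prod≡ = cong₂ _*_
          (prod-cong n (λ {i} _ i≤n → cong (rung i) ([≔]-≢ j jj (λ i≡ → <-irrefl i≡ (s≤s i≤n)))))
          (cong (rung (suc n)) ([≔]-≡ j (suc n) jj))
        prod≤X : prod (suc n) (value j′) ≤ X
        prod≤X = begin
          prod (suc n) (value j′)  ≡⟨ prod≡ ⟩
          prod n (value j) * v     ≤⟨ *-monoˡ-≤ v prod≤ ⟩
          X / v * v                ≤⟨ m/n*n≤m X v ⟩
          X                        ∎
        X<cprod : X < c * prod (suc n) (value j′)
        X<cprod = begin-strict
          X                              ≡⟨ m≡m%n+[m/n]*n X v ⟩
          X % v + X / v * v              <⟨ +-monoˡ-< (X / v * v) (m%n<n X v) ⟩
          suc (X / v) * v                ≤⟨ *-monoˡ-≤ v <cprod ⟩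
          c * prod n (value j) * v       ≡⟨ *-assoc c _ v ⟩
          c * (prod n (value j) * v)     ≡⟨ cong (c *_) (sym prod≡) ⟩
          c * prod (suc n) (value j′)    ∎

  cover : ∀ n X → lo n ≤ X → X < c * hi n → SmallSteps n → Covers n X
  cover zero    X lo≤X X<chi _     = (λ _ → 0) , (λ _ → z≤n) , lo≤X , X<chi
  cover (suc n) X lo≤X X<chi steps with highest-rung (lo n * m (suc n)) X (q (suc n)) (r (suc n)) lo≤X
  ... | jj , jj≤r , ≤X , top =
    put-on-top n X jj jj≤r (cover n (X / v) lo≤X/v (m<n*o⇒m/o<n (X<chi*v top)) (λ i i<n → steps i (m≤n⇒m≤1+n i<n)))
    where
      open ≤-Reasoning
      m′ = m (suc n)
      q′ = q (suc n)
      v = rung (suc n) jj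
      instance _ = rung≢0 (suc n) jj
      lo≤X/v : lo n ≤ X / v
      lo≤X/v = subst (_≤ X / v) (m*n/n≡m (lo n) v) (/-monoˡ-≤ v (subst (_≤ X) (*-assoc (lo n) _ _) ≤X))
      X<chi*v : jj ≡ r (suc n) ⊎ (jj < r (suc n) × X < lo n * m′ * q′ ^ suc jj) → X < c * hi n * v
      X<chi*v (inj₁ jj≡r) =
        subst (λ k → X < c * hi n * rung (suc n) k) (sym jj≡r) (subst (X <_) (sym (*-assoc c (hi n) _)) X<chi)
      X<chi*v (inj₂ (jj<r , X<)) = <-≤-trans X< (begin
        lo n * m′ * q′ ^ suc jj          ≡⟨ regroup (lo n) m′ q′ (q′ ^ jj) ⟩
        q′ * lo n * v                    ≤⟨ *-monoˡ-≤ v (*-monoˡ-≤ (lo n) (steps n ≤-refl (<-≤-trans z<s jj<r))) ⟩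
        c * W n * lo n * v               ≡⟨ cong (_* v) (trans (*-assoc c (W n) (lo n)) (cong (c *_) (trans (*-comm (W n) (lo n)) (sym (hi≡lo*W n))))) ⟩
        c * hi n * v                     ∎)
        where
          regroup : ∀ l m q x → l * m * (q * x) ≡ q * l * (m * x)
          regroup = solve-∀

log₂-bracket : ∀ N → 0 < N → ∃ λ t → 2 ^ t ≤ N × N < 2 ^ suc t
log₂-bracket N 0<N with least (λ t → N <? 2 ^ suc t) N (<-≤-trans (n<2^n N) (^-monoʳ-≤ 2 (n≤1+n N)))
... | zero  , N<2 , _     = 0 , 0<N , N<2
... | suc t , N<  , below = suc t , ≮⇒≥ (below ≤-refl) , N<

[1+x]⁴≤2x⁴ : ∀ x → 6 ≤ x → suc x * suc x * (suc x * suc x) ≤ 2 * (x * x * (x * x))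
[1+x]⁴≤2x⁴ x 6≤x = subst (λ y → suc y * suc y * (suc y * suc y) ≤ 2 * (y * y * (y * y))) (m+[n∸m]≡n 6≤x)
                     (≤-trans (m≤m+n _ _) (≤-reflexive (expand (x ∸ 6))))
  where
    expand : ∀ k → (7 + k) * (7 + k) * ((7 + k) * (7 + k))
                   + (k * k * (k * k) + 20 * (k * k * k) + 138 * (k * k) + 356 * k + 191)
                 ≡ 2 * ((6 + k) * (6 + k) * ((6 + k) * (6 + k)))
    expand = solve-∀

625x⁴≤2^x : ∀ x → 30 ≤ x → 625 * (x * x * (x * x)) ≤ 2 ^ x
625x⁴≤2^x x 30≤x with m≤n⇒m<n∨m≡n 30≤x
... | inj₂ refl = ≤ᵇ⇒≤ (625 * (30 * 30 * (30 * 30))) (2 ^ 30) tt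
... | inj₁ (s≤s {n = y} 30≤y) = begin
  625 * (suc y * suc y * (suc y * suc y))  ≤⟨ *-monoʳ-≤ 625 ([1+x]⁴≤2x⁴ y (≤-trans (m≤m+n 6 24) 30≤y)) ⟩
  625 * (2 * (y * y * (y * y)))            ≡⟨ x*[2*y]≡2*[x*y] 625 (y * y * (y * y)) ⟩
  2 * (625 * (y * y * (y * y)))            ≤⟨ *-monoʳ-≤ 2 (625x⁴≤2^x y 30≤y) ⟩
  2 * 2 ^ y                                ∎
  where
    open ≤-Reasoning
    x*[2*y]≡2*[x*y] : ∀ x y → x * (2 * y) ≡ 2 * (x * y)
    x*[2*y]≡2*[x*y] = solve-∀

root-window : ∀ K → 25 ≤ K → ∃ λ s → K + 5 ≤ s * s × 2 ≤ s × (s ∸ 2) * (s ∸ 1) < K × s * s ≤ 3 * K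
root-window K 25≤K with least (λ a → K + 5 ≤? (6 + a) * (6 + a)) K
                               (≤-trans (≤-reflexive (+-comm K 5)) (≤-trans (n≤1+n (5 + K)) (m≤m*n (6 + K) (6 + K))))
... | zero  , fits , _     = 6 , fits , ≤ᵇ⇒≤ 2 6 tt , ≤-trans (≤ᵇ⇒≤ 21 25 tt) 25≤K , ≤-trans (≤ᵇ⇒≤ 36 75 tt) (*-monoʳ-≤ 3 25≤K)
... | suc b , fits , below = 7 + b , fits , m≤m+n 2 (5 + b) , gap , square
  where
    open ≤-Reasoning
    prev : (6 + b) * (6 + b) ≤ K + 4
    prev = ≤-pred (subst ((6 + b) * (6 + b) <_) (+-suc K 4) (≰⇒> (below ≤-refl)))
    gap : (5 + b) * (6 + b) < K
    gap = +-cancelʳ-< 5 _ K (begin-strict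
      (5 + b) * (6 + b) + 5              <⟨ +-monoʳ-< ((5 + b) * (6 + b)) (s≤s (m≤m+n 5 b)) ⟩
      (5 + b) * (6 + b) + (6 + b)        ≡⟨ square-step b ⟩
      (6 + b) * (6 + b)                  ≤⟨ prev ⟩
      K + 4                              <⟨ +-monoʳ-< K (n<1+n 4) ⟩
      K + 5                              ∎)
      where
        square-step : ∀ b → (5 + b) * (6 + b) + (6 + b) ≡ (6 + b) * (6 + b)
        square-step = solve-∀
    square : (7 + b) * (7 + b) ≤ 3 * K
    square = begin
      (7 + b) * (7 + b)                  ≤⟨ m≤m+n _ _ ⟩
      (7 + b) * (7 + b) + (b * b + 10 * b + 23) ≡⟨ doubling b ⟩
      2 * ((6 + b) * (6 + b))            ≤⟨ *-monoʳ-≤ 2 prev ⟩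
      2 * (K + 4)                        ≤⟨ ≤-reflexive (*-distribˡ-+ 2 K 4) ⟩
      2 * K + 8                          ≤⟨ +-monoʳ-≤ (2 * K) (≤-trans (≤ᵇ⇒≤ 8 25 tt) 25≤K) ⟩
      2 * K + K                          ≡⟨ +-comm (2 * K) K ⟩
      3 * K                              ∎
      where
        doubling : ∀ b → (7 + b) * (7 + b) + (b * b + 10 * b + 23) ≡ 2 * ((6 + b) * (6 + b))
        doubling = solve-∀

2^Φ-bracket : ∀ M → 8 < M → ∃ λ e → M ≤ 2 ^ (2 * Φpp 2 (suc e)) × 2 ^ Φpp 2 (suc e) < M
2^Φ-bracket M 8<M with least (λ e → M ≤? 2 ^ (2 * Φpp 2 (suc e))) M
                              (≤-trans (<⇒≤ (n<2^n M)) (^-monoʳ-≤ 2 (≤-trans (e≤Φpp 2 M ≤-refl) (m≤m+n (Φpp 2 (suc M)) (Φpp 2 (suc M) + 0)))))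
... | zero   , fits , _     = 0 , fits , 8<M
... | suc e′ , fits , below = suc e′ , fits , subst (λ x → 2 ^ x < M) (sym (Φpp-suc 2 e′)) (≰⇒> (below ≤-refl))

K<R²*3a² : ∀ {K R a s} → K < R * (a * s) → s * s ≤ 3 * K → K < R * R * (3 * (a * a))
K<R²*3a² {K} {R} {a} {s} K<Ras s²≤3K = *-cancelʳ-< K K (R * R * (3 * (a * a))) (begin-strict
  K * K                          <⟨ *-mono-< K<Ras K<Ras ⟩
  R * (a * s) * (R * (a * s))    ≡⟨ regroup R a s ⟩
  R * R * (a * a) * (s * s)      ≤⟨ *-monoʳ-≤ (R * R * (a * a)) s²≤3K ⟩
  R * R * (a * a) * (3 * K)      ≡⟨ regroup′ (R * R) (a * a) K ⟩
  R * R * (3 * (a * a)) * K      ∎)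
  where
    open ≤-Reasoning
    regroup : ∀ R a s → R * (a * s) * (R * (a * s)) ≡ R * R * (a * a) * (s * s)
    regroup = solve-∀
    regroup′ : ∀ x y K → x * y * (3 * K) ≡ x * (3 * y) * K
    regroup′ = solve-∀

K<R²*c⇒2≤R : ∀ {K R c} → K < R * R * c → c ≤ K → 2 ≤ R
K<R²*c⇒2≤R {K} {R} {c} K<R²c c≤K with 2 ≤? R
... | yes 2≤R = 2≤R
... | no  2≰R = ⊥-elim (<⇒≱ K<R²c (≤-trans (*-monoˡ-≤ c (*-mono-≤ R≤1 R≤1)) (≤-trans (≤-reflexive (*-identityˡ c)) c≤K)))
  where
    R≤1 : R ≤ 1
    R≤1 = ≤-pred (≰⇒> 2≰R)

-- Opaque, so that the type checker never tries to normalise B = 2 ^ 2 ^ 40.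
opaque
  E : ℕ
  E = 2 ^ 40

  E≡2^40 : E ≡ 2 ^ 40
  E≡2^40 = refl

B : ℕ
B = 2 ^ E

module Construction (N : ℕ) (B<N : B < N) where

  2≤N : 2 ≤ N
  2≤N = ≤-trans (s≤s (m^n>0 2 E)) B<N

  private
    bracket : ∃ λ t → 2 ^ t ≤ N × N < 2 ^ suc t
    bracket = log₂-bracket N (<-trans z<s 2≤N)

  t : ℕ
  t = proj₁ bracket

  2^t≤N : 2 ^ t ≤ N
  2^t≤N = proj₁ (proj₂ bracket)

  N<2^[1+t] : N < 2 ^ suc t
  N<2^[1+t] = proj₂ (proj₂ bracket)

  2^40≤t : 2 ^ 40 ≤ t
  2^40≤t = subst (_≤ t) E≡2^40 (≤-pred (2^m<2^n⇒m<n {E} {suc t} (<-trans B<N N<2^[1+t])))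

  t-large : ∀ c → c ≤ 2 ^ 40 → c ≤ t
  t-large c c≤ = ≤-trans c≤ 2^40≤t

  K : ℕ
  K = 5 * t

  K-large : ∀ c → c ≤ 5 * 2 ^ 40 → c ≤ K
  K-large c c≤ = ≤-trans c≤ (*-monoʳ-≤ 5 2^40≤t)

  2^K≤N^5 : 2 ^ K ≤ N ^ 5
  2^K≤N^5 = begin
    2 ^ (5 * t)     ≡⟨ cong (2 ^_) (*-comm 5 t) ⟩
    2 ^ (t * 5)     ≡⟨ sym (^-*-assoc 2 t 5) ⟩
    (2 ^ t) ^ 5     ≤⟨ ^-monoˡ-≤ 5 2^t≤N ⟩
    N ^ 5           ∎
    where open ≤-Reasoning

  N^5<2^[K+5] : N ^ 5 < 2 ^ (K + 5)
  N^5<2^[K+5] = begin-strict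
    N ^ 5           <⟨ ^-monoˡ-< 5 N<2^[1+t] ⟩
    (2 ^ suc t) ^ 5 ≡⟨ ^-*-assoc 2 (suc t) 5 ⟩
    2 ^ (suc t * 5) ≡⟨ cong (2 ^_) (expand t) ⟩
    2 ^ (K + 5)     ∎
    where
      open ≤-Reasoning
      expand : ∀ t → suc t * 5 ≡ 5 * t + 5
      expand = solve-∀

  <K⇒LtClog : ∀ {x} → x < K → LtClog x 5 1 N
  <K⇒LtClog {x} x<K = begin-strict
    2 ^ (1 * x)     ≡⟨ cong (2 ^_) (*-identityˡ x) ⟩
    2 ^ x           <⟨ ^-monoʳ-< 2 ≤-refl x<K ⟩
    2 ^ K           ≤⟨ 2^K≤N^5 ⟩
    N ^ 5           ∎
    where open ≤-Reasoning

  private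
    window-root : ∃ λ s → K + 5 ≤ s * s × 2 ≤ s × (s ∸ 2) * (s ∸ 1) < K × s * s ≤ 3 * K
    window-root = root-window K (K-large 25 (≤ᵇ⇒≤ 25 _ tt))

  s : ℕ
  s = proj₁ window-root

  K+5≤s² : K + 5 ≤ s * s
  K+5≤s² = proj₁ (proj₂ window-root)

  2≤s : 2 ≤ s
  2≤s = proj₁ (proj₂ (proj₂ window-root))

  s-small : (s ∸ 2) * (s ∸ 1) < K
  s-small = proj₁ (proj₂ (proj₂ (proj₂ window-root)))

  s²≤3K : s * s ≤ 3 * K
  s²≤3K = proj₂ (proj₂ (proj₂ (proj₂ window-root)))

  s≤⇒SqrtClogLe : ∀ {x} → s ≤ x → SqrtClogLe x 5 1 N
  s≤⇒SqrtClogLe {x} s≤x = begin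
    N ^ 5               ≤⟨ <⇒≤ N^5<2^[K+5] ⟩
    2 ^ (K + 5)         ≤⟨ ^-monoʳ-≤ 2 (≤-trans K+5≤s² (*-mono-≤ s≤x s≤x)) ⟩
    2 ^ (x * x)         ≡⟨ cong (2 ^_) (sym (*-identityˡ (x * x))) ⟩
    2 ^ (1 * (x * x))   ∎
    where open ≤-Reasoning

  private
    last-bracket : ∃ λ e → N ^ 5 ≤ 2 ^ (2 * Φpp 2 (suc e)) × 2 ^ Φpp 2 (suc e) < N ^ 5
    last-bracket = 2^Φ-bracket (N ^ 5) (≤-trans (≤ᵇ⇒≤ 9 32 tt) (^-monoˡ-≤ 5 2≤N))

  e₂ : ℕ
  e₂ = proj₁ last-bracket

  f₂ : ℕ
  f₂ = Φpp 2 (suc e₂)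

  f₂-half : HalfClogLe f₂ 5 1 N
  f₂-half = proj₁ (proj₂ last-bracket)

  f₂-lt : LtClog f₂ 5 1 N
  f₂-lt = subst (λ x → 2 ^ x < N ^ 5) (sym (*-identityˡ f₂)) (proj₂ (proj₂ last-bracket))

  s≤f₂ : s ≤ f₂
  s≤f₂ = ≤-trans s≤2t (*-cancelˡ-≤ 2 (≤-trans 4t≤5t 5t≤2f₂))
    where
      5t≤2f₂ : 5 * t ≤ 2 * f₂
      5t≤2f₂ = 2^m≤2^n⇒m≤n {5 * t} {2 * f₂} (≤-trans 2^K≤N^5 f₂-half)
      4t≤5t : 2 * (2 * t) ≤ 5 * t
      4t≤5t = ≤-trans (≤-reflexive (sym (*-assoc 2 2 t))) (*-monoˡ-≤ t (≤ᵇ⇒≤ 4 5 tt))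
      s≤2t : s ≤ 2 * t
      s≤2t = m*m≤n*n⇒m≤n (begin
        s * s              ≤⟨ s²≤3K ⟩
        3 * (5 * t)        ≡⟨ sym (*-assoc 3 5 t) ⟩
        15 * t             ≤⟨ *-monoˡ-≤ t (≤-trans (≤ᵇ⇒≤ 15 16 tt) (*-monoʳ-≤ 4 (t-large 4 (≤ᵇ⇒≤ 4 _ tt)))) ⟩
        4 * t * t          ≡⟨ square t ⟩
        2 * t * (2 * t)    ∎)
        where
          open ≤-Reasoning
          square : ∀ t → 4 * t * t ≡ 2 * t * (2 * t)
          square = solve-∀

  f₂≤2K : f₂ ≤ 2 * K
  f₂≤2K = ≤-trans (≤-pred (subst (f₂ <_) (+-suc K 4) f₂<K+5)) K+4≤2K
    where
      f₂<K+5 : f₂ < K + 5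
      f₂<K+5 = 2^m<2^n⇒m<n {f₂} {K + 5} (<-trans (proj₂ (proj₂ last-bracket)) N^5<2^[K+5])
      K+4≤2K : K + 4 ≤ 2 * K
      K+4≤2K = ≤-trans (+-monoʳ-≤ K (K-large 4 (≤ᵇ⇒≤ 4 _ tt))) (≤-reflexive (cong (K +_) (sym (+-identityʳ K))))

  Y : ℕ
  Y = t + t + (t + t)

  Y+2≤K : Y + 2 ≤ K
  Y+2≤K = ≤-trans (+-monoʳ-≤ Y (t-large 2 (≤ᵇ⇒≤ 2 _ tt))) (≤-reflexive (five t))
    where
      five : ∀ t → t + t + (t + t) + t ≡ 5 * t
      five = solve-∀

  P : ℕ
  P = primeCount Y

  4≤P : 4 ≤ P
  4≤P = primeCount-mono-≤ {7} {Y} (≤-trans (t-large 7 (≤ᵇ⇒≤ 7 _ tt)) (≤-trans (m≤m+n t t) (m≤m+n (t + t) (t + t))))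

  P<K : P < K
  P<K = <-≤-trans (s≤s (primeCount≤1+x Y)) (≤-trans (≤-reflexive (+-comm 2 Y)) Y+2≤K)

  pr : ℕ → ℕ
  pr = nthPrimeUpTo Y

  pr-correct : ∀ {k} → 1 ≤ k → k ≤ P → pr k ≤ Y × IsNthPrime k (pr k)
  pr-correct = nthPrimeUpTo-correct Y

  q : ℕ → ℕ
  q k = 2 + (pr k ∸ 2)

  q≡pr : ∀ {k} → 1 ≤ k → k ≤ P → q k ≡ pr k
  q≡pr 1≤k k≤P = m+[n∸m]≡n (prime⇒2≤p (proj₁ (proj₂ (pr-correct 1≤k k≤P))))

  q≡nthPrime : ∀ {k p} → 1 ≤ k → k ≤ P → IsNthPrime k p → q k ≡ p
  q≡nthPrime 1≤k k≤P p-nth = trans (q≡pr 1≤k k≤P) (IsNthPrime-unique (proj₂ (pr-correct 1≤k k≤P)) p-nth)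

  q1≡2 : q 1 ≡ 2
  q1≡2 = q≡nthPrime ≤-refl (≤-trans (s≤s z≤n) 4≤P) (prime[2] , refl)

  q2≡3 : q 2 ≡ 3
  q2≡3 = q≡nthPrime (s≤s z≤n) (≤-trans (≤ᵇ⇒≤ 2 4 tt) 4≤P) (from-yes (prime? 3) , refl)

  q3≡5 : q 3 ≡ 5
  q3≡5 = q≡nthPrime (s≤s z≤n) (≤-trans (≤ᵇ⇒≤ 3 4 tt) 4≤P) (from-yes (prime? 5) , refl)

  q4≡7 : q 4 ≡ 7
  q4≡7 = q≡nthPrime (s≤s z≤n) 4≤P (from-yes (prime? 7) , refl)

  q≤7 : ∀ {k} → 2 ≤ k → k ≤ 4 → q k ≤ 7
  q≤7 {0} ()
  q≤7 {1} (s≤s ())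
  q≤7 {2} _ _ = ≤-trans (≤-reflexive q2≡3) (≤ᵇ⇒≤ 3 7 tt)
  q≤7 {3} _ _ = ≤-trans (≤-reflexive q3≡5) (≤ᵇ⇒≤ 5 7 tt)
  q≤7 {4} _ _ = ≤-reflexive q4≡7
  q≤7 {suc (suc (suc (suc (suc _))))} _ (s≤s (s≤s (s≤s (s≤s ()))))

  1+q<K : ∀ {k} → 1 ≤ k → k ≤ P → suc (q k) < K
  1+q<K {k} 1≤k k≤P = begin-strict
    suc (q k)    ≡⟨ cong suc (q≡pr 1≤k k≤P) ⟩
    suc (pr k)   ≤⟨ s≤s (proj₁ (pr-correct 1≤k k≤P)) ⟩
    suc Y        <⟨ ≤-reflexive (+-comm 2 Y) ⟩
    Y + 2        ≤⟨ Y+2≤K ⟩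
    K            ∎
    where open ≤-Reasoning

  module DialAt (k : ℕ) = Dial 2≤s s-small (pr k ∸ 2)

  -- Index k carries the k-th prime; index 1 (the prime 2) is frozen at f₂ by taking r 1 = 0.
  base : ℕ → ℕ
  base 1 = e₂
  base k = DialAt.e k

  r : ℕ → ℕ
  r 1 = 0
  r k = DialAt.r k

  m : ℕ → ℕ
  m k = Φpp (q k) (suc (base k))

  open Covering m q r (λ k → <-trans z<s (p<Φpp (q k) (base k) (s≤s z≤n))) (λ _ → z<s) 3

  R : ℕ → ℕ
  R k = q k ^ r k

  m1≡f₂ : m 1 ≡ f₂
  m1≡f₂ = cong (λ p → Φpp p (suc e₂)) q1≡2

  module _ {k′} (k≤P : 2 + k′ ≤ P) where

    in-window : ∀ {j} → j ≤ r (2 + k′) → s ≤ rung (2 + k′) j × rung (2 + k′) j < K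
    in-window = DialAt.window (2 + k′) (1+q<K (s≤s z≤n) k≤P)

    K<R²*7203 : 2 + k′ ≤ 4 → K < R (2 + k′) * R (2 + k′) * 7203
    K<R²*7203 k≤4 = <-≤-trans (K<R²*3a² {K} {R (2 + k′)} {q (2 + k′) * q (2 + k′)} {s} (DialAt.K<p^r*[p*p*s] (2 + k′)) s²≤3K)
                              (*-monoʳ-≤ (R (2 + k′) * R (2 + k′)) (*-monoʳ-≤ 3 (*-mono-≤ q²≤49 q²≤49)))
      where
        q²≤49 : q (2 + k′) * q (2 + k′) ≤ 49
        q²≤49 = *-mono-≤ (q≤7 (s≤s (s≤s z≤n)) k≤4) (q≤7 (s≤s (s≤s z≤n)) k≤4)

    2≤R : 2 + k′ ≤ 4 → 2 ≤ R (2 + k′)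
    2≤R k≤4 = K<R²*c⇒2≤R {K} {R (2 + k′)} {7203} (K<R²*7203 k≤4) (K-large 7203 (≤ᵇ⇒≤ 7203 _ tt))

    0<r⇒q²<K : 0 < r (2 + k′) → q (2 + k′) * q (2 + k′) < K
    0<r⇒q²<K = DialAt.0<r⇒p*p<K (2 + k′) (1+q<K (s≤s z≤n) k≤P)

  W2≡R2 : W 2 ≡ R 2
  W2≡R2 = +-identityʳ (R 2)

  W3≡R2*R3 : W 3 ≡ R 2 * R 3
  W3≡R2*R3 = cong (_* R 3) W2≡R2

  W-mono : ∀ {a b} → a ≤ b → W a ≤ W b
  W-mono = prod-mono-length (λ i → q i ^ r i) (λ i → m^n>0 (q i) (r i))

  K<W4 : K < W 4
  K<W4 = m*m<n*n⇒m<n {K} {W 4} (x*y<z*c⇒y<z {K} {K * K} {W 4 * W 4} {7203 * 7203 * 7203} (begin-strict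
    K * (K * K)                                                       <⟨ *-mono-< K<R²₂ (*-mono-< K<R²₃ K<R²₄) ⟩
    R 2 * R 2 * 7203 * (R 3 * R 3 * 7203 * (R 4 * R 4 * 7203))       ≡⟨ regroup (R 2) (R 3) (R 4) 7203 ⟩
    R 2 * R 3 * R 4 * (R 2 * R 3 * R 4) * (7203 * 7203 * 7203)       ≡⟨ cong (λ w → w * R 4 * (w * R 4) * (7203 * 7203 * 7203)) (sym W3≡R2*R3) ⟩
    W 4 * W 4 * (7203 * 7203 * 7203)                                  ∎) (K-large _ (≤ᵇ⇒≤ _ _ tt)))
    where
      open ≤-Reasoning
      K<R²₂ : K < R 2 * R 2 * 7203
      K<R²₂ = K<R²*7203 {0} (≤-trans (≤ᵇ⇒≤ 2 4 tt) 4≤P) (≤ᵇ⇒≤ 2 4 tt)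
      K<R²₃ : K < R 3 * R 3 * 7203
      K<R²₃ = K<R²*7203 {1} (≤-trans (≤ᵇ⇒≤ 3 4 tt) 4≤P) (≤ᵇ⇒≤ 3 4 tt)
      K<R²₄ : K < R 4 * R 4 * 7203
      K<R²₄ = K<R²*7203 {2} 4≤P ≤-refl
      regroup : ∀ x y z c → x * x * c * (y * y * c * (z * z * c)) ≡ x * y * z * (x * y * z) * (c * c * c)
      regroup = solve-∀

  small-steps : ∀ {n} → n ≤ P → SmallSteps n
  small-steps n≤P 0 _ ()
  small-steps n≤P 1 _ _ = ≤-reflexive q2≡3
  small-steps n≤P 2 _ _ = begin
    q 3          ≡⟨ q3≡5 ⟩
    5            ≤⟨ ≤ᵇ⇒≤ 5 6 tt ⟩
    3 * 2        ≤⟨ *-monoʳ-≤ 3 (2≤R {0} (≤-trans (≤ᵇ⇒≤ 2 4 tt) 4≤P) (≤ᵇ⇒≤ 2 4 tt)) ⟩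
    3 * R 2      ≡⟨ cong (3 *_) (sym W2≡R2) ⟩
    3 * W 2      ∎
    where open ≤-Reasoning
  small-steps n≤P 3 _ _ = begin
    q 4              ≡⟨ q4≡7 ⟩
    7                ≤⟨ ≤ᵇ⇒≤ 7 12 tt ⟩
    3 * (2 * 2)      ≤⟨ *-monoʳ-≤ 3 (*-mono-≤ (2≤R {0} (≤-trans (≤ᵇ⇒≤ 2 4 tt) 4≤P) (≤ᵇ⇒≤ 2 4 tt))
                                              (2≤R {1} (≤-trans (≤ᵇ⇒≤ 3 4 tt) 4≤P) (≤ᵇ⇒≤ 3 4 tt))) ⟩
    3 * (R 2 * R 3)  ≡⟨ cong (3 *_) (sym W3≡R2*R3) ⟩
    3 * W 3          ∎
    where open ≤-Reasoning
  small-steps n≤P (suc (suc (suc (suc i)))) 4+i<n 0<r = ≤-trans (<⇒≤ q<W) (m≤n*m (W (4 + i)) 3)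
    where
      q<W : q (5 + i) < W (4 + i)
      q<W = m*m<n*n⇒m<n {q (5 + i)} {W (4 + i)} (begin-strict
        q (5 + i) * q (5 + i)   <⟨ 0<r⇒q²<K {3 + i} (≤-trans 4+i<n n≤P) 0<r ⟩
        K                       <⟨ K<W4 ⟩
        W 4                     ≤⟨ W-mono {4} {4 + i} (s≤s (s≤s (s≤s (s≤s z≤n)))) ⟩
        W (4 + i)               ≤⟨ m≤m*n (W (4 + i)) (W (4 + i)) {{>-nonZero (W-mono {0} {4 + i} z≤n)}} ⟩
        W (4 + i) * W (4 + i)   ∎)
        where open ≤-Reasoning

  s≤value-r : ∀ {k} → 1 ≤ k → k ≤ P → s ≤ value r k
  s≤value-r {1}               _ _   = ≤-trans s≤f₂ (≤-reflexive (trans (sym m1≡f₂) (sym (*-identityʳ (m 1)))))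
  s≤value-r {suc (suc k′)}    _ k≤P = proj₁ (in-window k≤P ≤-refl)

  value-r≤K : ∀ {k} → 2 ≤ k → k ≤ P → value r k ≤ K
  value-r≤K {suc (suc k′)} _ k≤P = <⇒≤ (proj₂ (in-window k≤P ≤-refl))
  value-r≤K {1} (s≤s ())

  2^[2+t]≤s^P : 2 ^ (2 + t) ≤ s ^ P
  2^[2+t]≤s^P = m*m≤n*n⇒m≤n {2 ^ (2 + t)} {s ^ P} (*-cancelʳ-≤ _ _ (s * s) {{s²≢0}} (begin
    2 ^ (2 + t) * 2 ^ (2 + t) * (s * s)   ≤⟨ *-monoʳ-≤ (2 ^ (2 + t) * 2 ^ (2 + t)) s²≤3K ⟩
    2 ^ (2 + t) * 2 ^ (2 + t) * (3 * K)   ≡⟨ regroup (2 ^ t) t ⟩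
    2 ^ t * 2 ^ t * (240 * t)             ≤⟨ *-monoʳ-≤ (2 ^ t * 2 ^ t) 240t≤2^t ⟩
    2 ^ t * 2 ^ t * 2 ^ t                 ≤⟨ *-monoʳ-≤ (2 ^ t * 2 ^ t) (m≤m*n (2 ^ t) (2 ^ t) {{m^n≢0 2 t}}) ⟩
    2 ^ t * 2 ^ t * (2 ^ t * 2 ^ t)       ≡⟨ sym 2^Y≡ ⟩
    2 ^ Y                                 ≤⟨ chebyshev (t + t) (≤-trans (t-large 1 (≤ᵇ⇒≤ 1 _ tt)) (m≤m+n t t)) ⟩
    suc Y ^ suc P                         ≤⟨ ^-monoˡ-≤ (suc P) 1+Y≤s² ⟩
    s * s * (s * s) ^ P                   ≡⟨ cong (s * s *_) (^-distribʳ-* s s P) ⟩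
    s * s * (s ^ P * s ^ P)               ≡⟨ *-comm (s * s) (s ^ P * s ^ P) ⟩
    s ^ P * s ^ P * (s * s)               ∎))
    where
      open ≤-Reasoning
      s²≢0 : NonZero (s * s)
      s²≢0 = >-nonZero (*-mono-≤ (≤-trans (s≤s z≤n) 2≤s) (≤-trans (s≤s z≤n) 2≤s))
      regroup : ∀ x t → 2 * (2 * x) * (2 * (2 * x)) * (3 * (5 * t)) ≡ x * x * (240 * t)
      regroup = solve-∀
      240t≤2^t : 240 * t ≤ 2 ^ t
      240t≤2^t = ≤-trans (*-mono-≤ (≤ᵇ⇒≤ 240 625 tt) t≤t⁴) (625x⁴≤2^x t (t-large 30 (≤ᵇ⇒≤ 30 _ tt)))
        where
          instance
            t≢0 : NonZero t
            t≢0 = >-nonZero (t-large 1 (≤ᵇ⇒≤ 1 _ tt))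
          t≤t⁴ : t ≤ t * t * (t * t)
          t≤t⁴ = ≤-trans (m≤m*n t t) (m≤m*n (t * t) (t * t) {{m*n≢0 t t}})
      2^Y≡ : 2 ^ Y ≡ 2 ^ t * 2 ^ t * (2 ^ t * 2 ^ t)
      2^Y≡ = trans (^-distribˡ-+-* 2 (t + t) (t + t)) (cong₂ _*_ (^-distribˡ-+-* 2 t t) (^-distribˡ-+-* 2 t t))
      1+Y≤s² : suc Y ≤ s * s
      1+Y≤s² = ≤-trans (≤-trans (<⇒≤ (≤-reflexive (+-comm 2 Y))) Y+2≤K) (≤-trans (m≤m+n K 5) K+5≤s²)

  6N<3*hi[P] : 6 * N < 3 * hi P
  6N<3*hi[P] = begin-strict
    6 * N                  <⟨ *-monoʳ-< 6 N<2^[1+t] ⟩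
    6 * (2 * 2 ^ t)        ≡⟨ regroup (2 ^ t) ⟩
    3 * 2 ^ (2 + t)        ≤⟨ *-monoʳ-≤ 3 2^[2+t]≤s^P ⟩
    3 * s ^ P              ≡⟨ cong (3 *_) (sym (prod-const P s)) ⟩
    3 * prod P (λ _ → s)   ≤⟨ *-monoʳ-≤ 3 (prod-mono-≤ P s≤value-r) ⟩
    3 * hi P               ∎
    where
      open ≤-Reasoning
      regroup : ∀ x → 6 * (2 * x) ≡ 3 * (2 * (2 * x))
      regroup = solve-∀

  3*hi[4]≤6N : 3 * hi 4 ≤ 6 * N
  3*hi[4]≤6N = begin
    3 * hi 4                          ≤⟨ *-monoʳ-≤ 3 (prod-mono-≤ 4 value-r≤cap) ⟩
    3 * prod 4 cap                    ≡⟨ expand t ⟩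
    6 * (625 * (t * t * (t * t)))     ≤⟨ *-monoʳ-≤ 6 (625x⁴≤2^x t (t-large 30 (≤ᵇ⇒≤ 30 _ tt))) ⟩
    6 * 2 ^ t                         ≤⟨ *-monoʳ-≤ 6 2^t≤N ⟩
    6 * N                             ∎
    where
      open ≤-Reasoning
      cap : ℕ → ℕ
      cap 1 = 2 * K
      cap _ = K
      value-r≤cap : ∀ {k} → 1 ≤ k → k ≤ 4 → value r k ≤ cap k
      value-r≤cap {1}            _ _   = ≤-trans (≤-reflexive (trans (*-identityʳ (m 1)) m1≡f₂)) f₂≤2K
      value-r≤cap {suc (suc k′)} _ k≤4 = value-r≤K (s≤s (s≤s z≤n)) (≤-trans k≤4 4≤P)
      expand : ∀ t → 3 * (1 * (2 * (5 * t)) * (5 * t) * (5 * t) * (5 * t)) ≡ 6 * (625 * (t * t * (t * t)))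
      expand = solve-∀

  m[1+n]≤3*W[n] : ∀ {n} → 4 ≤ n → suc n ≤ P → m (suc n) ≤ 3 * W n
  m[1+n]≤3*W[n] {suc n′} 4≤n 1+n≤P = begin
    m (2 + n′)                ≡⟨ sym (*-identityʳ (m (2 + n′))) ⟩
    rung (2 + n′) 0           <⟨ proj₂ (in-window 1+n≤P z≤n) ⟩
    K                         <⟨ K<W4 ⟩
    W 4                       ≤⟨ W-mono 4≤n ⟩
    W (suc n′)                ≤⟨ m≤n*m (W (suc n′)) 3 ⟩
    3 * W (suc n′)            ∎
    where open ≤-Reasoning

  lo[1+n]≤6N : ∀ {n} → 4 ≤ n → suc n ≤ P → 3 * hi n ≤ 6 * N → lo (suc n) ≤ 6 * N
  lo[1+n]≤6N {n} 4≤n 1+n≤P 3hi≤6N = begin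
    lo n * m (suc n)       ≤⟨ *-monoʳ-≤ (lo n) (m[1+n]≤3*W[n] 4≤n 1+n≤P) ⟩
    lo n * (3 * W n)       ≡⟨ x*[3*y]≡3*[x*y] (lo n) (W n) ⟩
    3 * (lo n * W n)       ≡⟨ cong (3 *_) (sym (hi≡lo*W n)) ⟩
    3 * hi n               ≤⟨ 3hi≤6N ⟩
    6 * N                  ∎
    where
      open ≤-Reasoning
      x*[3*y]≡3*[x*y] : ∀ x y → x * (3 * y) ≡ 3 * (x * y)
      x*[3*y]≡3*[x*y] = solve-∀

  Decomposition : Set
  Decomposition =
    Σ ℕ λ n → Σ (ℕ → ℕ) λ e → Σ (ℕ → ℕ) λ ℓ →
      (1 ≤ n × LtClog n 5 1 N
       × (∀ i → 1 ≤ i → i ≤ n → IsNthPrime (n ∸ i + 1) (ℓ i))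
       × (∀ i → 1 ≤ i → i ≤ n ∸ 1 → SqrtClogLe (Φpp (ℓ i) (e i)) 5 1 N × LtClog (Φpp (ℓ i) (e i)) 5 1 N)
       × HalfClogLe (Φpp (ℓ n) (e n)) 5 1 N
       × LtClog (Φpp (ℓ n) (e n)) 5 1 N
       × 2 * N ≤ 1 * prod n (λ i → Φpp (ℓ i) (e i))
       × 1 * prod n (λ i → Φpp (ℓ i) (e i)) < 7 * N)

  module Witness (n′ : ℕ) (n≤P : suc n′ ≤ P) (j : ℕ → ℕ) (j≤r : ∀ k → j k ≤ r k)
                 (S≤6N : prod (suc n′) (value j) ≤ 6 * N) (6N<3S : 6 * N < 3 * prod (suc n′) (value j)) where

    n : ℕ
    n = suc n′

    exponent : ℕ → ℕ
    exponent k = suc (base k) + j k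

    ℓ e : ℕ → ℕ
    ℓ i = pr (n ∸ i + 1)
    e i = exponent (n ∸ i + 1)

    Φ≡value : ∀ {k} → 1 ≤ k → k ≤ n → Φpp (pr k) (exponent k) ≡ value j k
    Φ≡value {k} 1≤k k≤n = trans (cong (λ p → Φpp p (exponent k)) (sym (q≡pr 1≤k (≤-trans k≤n n≤P))))
                                (Φpp-+ (q k) (base k) (j k))

    product≡ : prod n (λ i → Φpp (ℓ i) (e i)) ≡ prod n (value j)
    product≡ = trans (prod-reverse n (λ k → Φpp (pr k) (exponent k))) (prod-cong n Φ≡value)

    1≤n∸i+1 : ∀ i → 1 ≤ n ∸ i + 1
    1≤n∸i+1 i = m≤n+m 1 (n ∸ i)

    n∸i+1≤n : ∀ {i} → 1 ≤ i → n ∸ i + 1 ≤ n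
    n∸i+1≤n {i} 1≤i = ≤-trans (+-monoˡ-≤ 1 (∸-monoʳ-≤ n 1≤i)) (≤-reflexive (+-comm n′ 1))

    2≤n∸i+1 : ∀ {i} → i ≤ n ∸ 1 → 2 ≤ n ∸ i + 1
    2≤n∸i+1 i≤n′ = +-monoˡ-≤ 1 (m<n⇒0<n∸m (s≤s i≤n′))

    primes : ∀ i → 1 ≤ i → i ≤ n → IsNthPrime (n ∸ i + 1) (ℓ i)
    primes i 1≤i _ = proj₂ (pr-correct (1≤n∸i+1 i) (≤-trans (n∸i+1≤n 1≤i) n≤P))

    value-window : ∀ {k} → 2 ≤ k → k ≤ n → s ≤ value j k × value j k < K
    value-window {suc (suc k′)} _ k≤n = in-window (≤-trans k≤n n≤P) (j≤r (2 + k′))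
    value-window {1} (s≤s ())

    windows : ∀ i → 1 ≤ i → i ≤ n ∸ 1 → SqrtClogLe (Φpp (ℓ i) (e i)) 5 1 N × LtClog (Φpp (ℓ i) (e i)) 5 1 N
    windows i 1≤i i≤n′ = s≤⇒SqrtClogLe (subst (s ≤_) (sym Φ≡) (proj₁ v-window)) , <K⇒LtClog (subst (_< K) (sym Φ≡) (proj₂ v-window))
      where
        v-window : s ≤ value j (n ∸ i + 1) × value j (n ∸ i + 1) < K
        v-window = value-window (2≤n∸i+1 i≤n′) (n∸i+1≤n 1≤i)
        Φ≡ : Φpp (ℓ i) (e i) ≡ value j (n ∸ i + 1)
        Φ≡ = Φ≡value (1≤n∸i+1 i) (n∸i+1≤n 1≤i)

    last≡f₂ : Φpp (ℓ n) (e n) ≡ f₂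
    last≡f₂ = begin
      Φpp (ℓ n) (e n)           ≡⟨ cong (λ k → Φpp (pr k) (exponent k)) (cong (_+ 1) (n∸n≡0 n)) ⟩
      Φpp (pr 1) (exponent 1)   ≡⟨ Φ≡value ≤-refl (s≤s z≤n) ⟩
      m 1 * q 1 ^ j 1           ≡⟨ cong (λ x → m 1 * q 1 ^ x) (n≤0⇒n≡0 (j≤r 1)) ⟩
      m 1 * 1                   ≡⟨ trans (*-identityʳ (m 1)) m1≡f₂ ⟩
      f₂                        ∎
      where open ≡-Reasoning

    decomposition : Decomposition
    decomposition =
      n , e , ℓ , s≤s z≤n , <K⇒LtClog (≤-<-trans n≤P P<K) , primes , windows ,
      subst (λ x → HalfClogLe x 5 1 N) (sym last≡f₂) f₂-half ,
      subst (λ x → LtClog x 5 1 N) (sym last≡f₂) f₂-lt ,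
      ≤-trans (<⇒≤ 2N<S) (≤-reflexive (sym 1*Π≡S)) ,
      ≤-<-trans (≤-trans (≤-reflexive 1*Π≡S) S≤6N) 6N<7N
      where
        S = prod n (value j)
        6N<7N : 6 * N < 7 * N
        6N<7N = *-monoˡ-< N {{>-nonZero (≤-trans (s≤s z≤n) 2≤N)}} (≤ᵇ⇒≤ 7 7 tt)
        1*Π≡S : 1 * prod n (λ i → Φpp (ℓ i) (e i)) ≡ S
        1*Π≡S = trans (*-identityˡ _) product≡
        2N<S : 2 * N < S
        2N<S = *-cancelˡ-< 3 (2 * N) S (subst (_< 3 * S) (*-assoc 3 2 N) 6N<3S)

  decomposition : Decomposition
  decomposition = choose-length (crossing (λ n → 3 * hi n) (6 * N) 4≤P 3*hi[4]≤6N 6N<3*hi[P])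
    where
      choose-length : (∃ λ n′ → 4 ≤ n′ × n′ < P × 3 * hi n′ ≤ 6 * N × 6 * N < 3 * hi (suc n′)) → Decomposition
      choose-length (n′ , 4≤n′ , n′<P , 3hi≤6N , 6N<3hi) =
        choose-exponents (cover (suc n′) (6 * N) (lo[1+n]≤6N 4≤n′ n′<P 3hi≤6N) 6N<3hi (small-steps n′<P))
        where
          choose-exponents : Covers (suc n′) (6 * N) → Decomposition
          choose-exponents (j , j≤r , S≤6N , 6N<3S) = Witness.decomposition n′ n′<P j j≤r S≤6N 6N<3S

lemma1 : ∃[ B ] ∃[ c ] ∃[ d ] ∃[ a ] ∃[ b ] ∃[ p₁ ] ∃[ q₁ ] ∃[ p₂ ] Σ ℕ λ q₂ →
           (0 < d × 0 < a × 0 < b × 0 < q₁ × 0 < q₂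
            × q₁ < p₁ × p₁ * q₂ < p₂ * q₁
            × (∀ N → B < N →
                 Σ ℕ λ n → Σ (ℕ → ℕ) λ e → Σ (ℕ → ℕ) λ ℓ →
                   (1 ≤ n × LtClog n c d N
                    × (∀ i → 1 ≤ i → i ≤ n → IsNthPrime (n ∸ i + 1) (ℓ i))
                    × (∀ i → 1 ≤ i → i ≤ n ∸ 1 →
                         SqrtClogLe (Φpp (ℓ i) (e i)) a b N
                         × LtClog (Φpp (ℓ i) (e i)) a b N)
                    × HalfClogLe (Φpp (ℓ n) (e n)) a b N
                    × LtClog (Φpp (ℓ n) (e n)) a b N
                    × p₁ * N ≤ q₁ * prod n (λ i → Φpp (ℓ i) (e i))
                    × q₂ * prod n (λ i → Φpp (ℓ i) (e i)) < p₂ * N)))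
lemma1 = B , 5 , 1 , 5 , 1 , 2 , 1 , 7 , 1 , z<s , z<s , z<s , z<s , z<s , ≤-refl , ≤ᵇ⇒≤ 3 7 tt ,
         Construction.decomposition
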